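{- Let $k \ge 2$ and let $(X,\mathcal{L})$ be a finite projective plane of order $k$. Let $G$ be its incidence graph, i.e. the bipartite graph with vertex set $X \cup \mathcal{L}$ in which a point $x \in X$ is adjacent to a line $\ell \in \mathcal{L}$ if and only if $x \in \ell$. Then $\mathrm{fun}(G) = k+1$. Moreover, for every proper induced subgraph $G'$ of $G$ we have $\mathrm{fun}(G') \le k$.
   Context: A finite projective plane is a pair $(X,\mathcal{L})$ with $X$ a finite set and $\mathcal{L}\subseteq 2^X$ such that: any two distinct points lie in exactly one common line; any two distinct lines meet in exactly one point; and there is a set $Y\subseteq X$ of four points with $|L\cap Y|\le 2$ for every $L\in\mathcal{L}$. It has order $k$ if every line contains exactly $k+1$ points (then every point lies on $k+1$ lines and there are $k^2+k+1$ points and $k^2+k+1$ lines). Functionality: let $G=(V,E)$ be a finite simple graph with adjacency matrix $A$. A vertex $v$ is a function of distinct vertices $u_1,\dots,u_k \in V\setminus\{v\}$ if there is a Boolean function $f:\{0,1\}^k\to\{0,1\}$ such that for every vertex $w \in V\setminus\{v,u_1,\dots,u_k\}$ we have $A[v,w] = f(A[w,u_1],\dots,A[w,u_k])$. The functionality $\mathrm{fun}_G(v)$ is the minimum $k$ such that $v$ is a function of some $k$ vertices of $G$. The functionality of $G$ is $\mathrm{fun}(G)=\max_{H}\min_{v\in V(H)} \mathrm{fun}_H(v)$, the maximum taken over all (nonempty) induced subgraphs $H$ of $G$. -}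

module Defs where

open import Data.Nat using (ℕ; suc; _+_; _≤_; _<_)
open import Data.Bool using (Bool; true; false)
open import Data.Fin using (Fin; splitAt)
open import Data.Fin.Subset using (Subset; _∈_; _∩_; ∣_∣; _⊆_; Nonempty)
open import Data.Vec using (Vec; lookup; map)
open import Data.Sum using (_⊎_; inj₁; inj₂)
open import Data.Product using (Σ; ∃; _×_)
open import Relation.Binary.PropositionalEquality using (_≡_; _≢_)
open import Relation.Nullary using (¬_)

-- Finite projective planes.
-- Points are Fin n; the set of lines L ⊆ 2^X is given as an injective
-- family  line : Fin m → Subset n  (so L = image of line, |L| = m).

Injective : ∀ {A B : Set} → (A → B) → Set
Injective f = ∀ a b → f a ≡ f b → a ≡ b

record IsProjectivePlane {n m : ℕ} (line : Fin m → Subset n) : Set where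
  field
    linesDistinct : Injective line
    pointsJoin : ∀ (x y : Fin n) → x ≢ y →
      Σ (Fin m) λ l → (x ∈ line l) × (y ∈ line l) ×
        (∀ l' → x ∈ line l' → y ∈ line l' → l' ≡ l)
    linesMeet : ∀ (l l' : Fin m) → l ≢ l' →
      Σ (Fin n) λ x → (x ∈ line l) × (x ∈ line l') ×
        (∀ y → y ∈ line l → y ∈ line l' → y ≡ x)
    fourPoints : Σ (Subset n) λ Y → (∣ Y ∣ ≡ 4) × (∀ l → ∣ line l ∩ Y ∣ ≤ 2)

HasOrder : ∀ {n m : ℕ} → ℕ → (Fin m → Subset n) → Set
HasOrder k line = ∀ l → ∣ line l ∣ ≡ suc k

-- Incidence graph on vertex set Fin (n + m): points first, then lines.

incAdj : ∀ {n m : ℕ} → (Fin m → Subset n) → Fin (n + m) → Fin (n + m) → Bool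
incAdj {n} line u v with splitAt n u | splitAt n v
... | inj₁ x | inj₂ l = lookup (line l) x
... | inj₂ l | inj₁ x = lookup (line l) x
... | inj₁ _ | inj₁ _ = false
... | inj₂ _ | inj₂ _ = false

-- Functionality.  A graph on Fin N is given by its adjacency matrix
-- A : Fin N → Fin N → Bool; an induced subgraph by a vertex set S.

FunctionOf : ∀ {N : ℕ} → (Fin N → Fin N → Bool) → Subset N → Fin N → ℕ → Set
FunctionOf {N} A S v i =
  Σ (Vec (Fin N) i) λ us →
    (∀ p → lookup us p ∈ S) ×
    (∀ p → lookup us p ≢ v) ×
    (∀ p q → lookup us p ≡ lookup us q → p ≡ q) ×
    Σ (Vec Bool i → Bool) λ f →
      ∀ w → w ∈ S → w ≢ v → (∀ p → w ≢ lookup us p) →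
        A v w ≡ f (map (λ u → A w u) us)

FunVertexLe : ∀ {N : ℕ} → (Fin N → Fin N → Bool) → Subset N → Fin N → ℕ → Set
FunVertexLe A S v t = Σ ℕ λ i → (i ≤ t) × FunctionOf A S v i

FunLe : ∀ {N : ℕ} → (Fin N → Fin N → Bool) → Subset N → ℕ → Set
FunLe A S t = ∀ S' → S' ⊆ S → Nonempty S' →
  Σ _ λ v → (v ∈ S') × FunVertexLe A S' v t

-- fun(G[S]) = t  (t is the least bound, i.e. the max-min value)
FunEq : ∀ {N : ℕ} → (Fin N → Fin N → Bool) → Subset N → ℕ → Set
FunEq A S t = FunLe A S t × (∀ t' → t' < t → ¬ FunLe A S t')

module Submission where

-- Every vertex has k + 1 neighbours and, having no loop, is the constant function false of
-- them; so fun(G) ≤ k + 1, and a proper induced subgraph, G being connected, contains a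
-- vertex that has lost a neighbour, whence fun ≤ k there.  Conversely, given a vertex v and
-- at most k other vertices U, counting yields two vertices outside U ∪ {v}, both adjacent to
-- nothing in U, exactly one of them adjacent to v; then v is no function of U.  For a line v
-- take a point x of v avoided by U, and either a line through x avoiding U (when U contains a
-- line, which is then free to block v itself) or a point off v outside U.  Points v are lines
-- of the dual plane.

open import Defs
open import Data.Nat using (ℕ; suc; _+_; _≤_; _<_; z≤n; s≤s)
open import Data.Nat.Properties using (≤-trans; ≤-pred; <⇒≱)
open import Data.Bool using (Bool; true; false)
open import Data.Bool.Properties using (¬-not) renaming (_≟_ to _≟ᵇ_)
open import Data.Fin using (Fin; zero; suc; punchIn; splitAt; join)
open import Data.Fin.Properties
  using (_≟_; suc-injective; injective⇒≤; punchIn-injective; punchOut-injective; any?; all?; splitAt-join; join-splitAt)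
open import Data.Fin.Subset using (Subset; _∈_; _∉_; _∩_; ∣_∣; ⊤; Nonempty)
open import Data.Fin.Subset.Properties using (drop-there; x∈p∩q⁻; x∈p∩q⁺; _∈?_; ∈⊤; ⊆⊤; ⊆-antisym)
open import Data.Vec using (Vec; []; _∷_; here; there; lookup; tabulate; map)
open import Data.Vec.Properties using (lookup∘tabulate; []=⇒lookup; lookup⇒[]=)
open import Data.Sum using (_⊎_; inj₁; inj₂; swap)
open import Data.Sum.Properties using (inj₁-injective; inj₂-injective; swap-involutive; ≡-dec)
open import Data.Product using (Σ; ∃; _×_; _,_; proj₁; proj₂; map₂)
open import Data.Empty using (⊥-elim)
open import Relation.Nullary using (¬_; Dec; yes; no; contradiction)
open import Relation.Nullary.Decidable using (¬?; _×-dec_; decidable-stable)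
open import Relation.Binary.PropositionalEquality
  using (_≡_; _≢_; refl; sym; trans; cong; cong₂; subst; module ≡-Reasoning)

-- Enumerations and counting

Covers : ∀ {A : Set} {d} → (Fin d → A) → (A → Set) → Set
Covers e P = ∀ x → P x → ∃ λ a → e a ≡ x

record Enumeration {A : Set} (d : ℕ) (P : A → Set) : Set where
  field
    elem : Fin d → A
    elem∈ : ∀ a → P (elem a)
    elem-injective : ∀ {a b} → elem a ≡ elem b → a ≡ b
    elem-onto : Covers elem P

open Enumeration

enumerate : ∀ {n} (p : Subset n) → Enumeration ∣ p ∣ (_∈ p)
enumerate [] = record { elem = λ () ; elem∈ = λ () ; elem-injective = λ { {()} } ; elem-onto = λ _ () }
enumerate (false ∷ p) = record
  { elem = λ a → suc (elem E a)
  ; elem∈ = λ a → there (elem∈ E a)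
  ; elem-injective = λ eq → elem-injective E (suc-injective eq)
  ; elem-onto = onto
  }
  where
  E = enumerate p
  onto : Covers (λ a → suc (elem E a)) (_∈ false ∷ p)
  onto (suc x) x∈ with elem-onto E x (drop-there x∈)
  ... | a , eq = a , cong suc eq
enumerate (true ∷ p) = record { elem = e ; elem∈ = e∈ ; elem-injective = e-injective ; elem-onto = onto }
  where
  E = enumerate p
  e : Fin (suc ∣ p ∣) → Fin _
  e zero = zero
  e (suc a) = suc (elem E a)
  e∈ : ∀ a → e a ∈ true ∷ p
  e∈ zero = here
  e∈ (suc a) = there (elem∈ E a)
  e-injective : ∀ {a b} → e a ≡ e b → a ≡ b
  e-injective {zero} {zero} _ = refl
  e-injective {suc a} {suc b} eq = cong suc (elem-injective E (suc-injective eq))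
  onto : Covers e (_∈ true ∷ p)
  onto zero _ = zero , refl
  onto (suc x) x∈ with elem-onto E x (drop-there x∈)
  ... | a , eq = suc a , cong suc eq

enumerateOfSize : ∀ {n d} (p : Subset n) → ∣ p ∣ ≡ d → Enumeration d (_∈ p)
enumerateOfSize p refl = enumerate p

Enumeration-⇔ : ∀ {A : Set} {P Q : A → Set} {d} → (∀ {x} → P x → Q x) → (∀ {x} → Q x → P x) →
                Enumeration d P → Enumeration d Q
Enumeration-⇔ P⇒Q Q⇒P E = record
  { elem = elem E
  ; elem∈ = λ a → P⇒Q (elem∈ E a)
  ; elem-injective = elem-injective E
  ; elem-onto = λ x Qx → elem-onto E x (Q⇒P Qx)
  }

injective-missing⇒< : ∀ {c d} (f : Fin c → Fin d) → (∀ {i j} → f i ≡ f j → i ≡ j) →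
                      ∀ a → (∀ i → a ≢ f i) → c < d
injective-missing⇒< {d = suc d} f f-injective a a∉f =
  s≤s (injective⇒≤ (λ eq → f-injective (punchOut-injective (a∉f _) (a∉f _) eq)))

module _ {A : Set} {P : A → Set} {c d} {e : Fin d → A} (cover : Covers e P)
         (g : Fin c → A) (g∈P : ∀ i → P (g i)) where

  coverIndex : Fin c → Fin d
  coverIndex i = proj₁ (cover (g i) (g∈P i))

  e∘coverIndex : ∀ i → e (coverIndex i) ≡ g i
  e∘coverIndex i = proj₂ (cover (g i) (g∈P i))

  coverIndex-injective : (∀ {i j} → g i ≡ g j → i ≡ j) → ∀ {i j} → coverIndex i ≡ coverIndex j → i ≡ j
  coverIndex-injective g-injective {i} {j} eq =
    g-injective (trans (sym (e∘coverIndex i)) (trans (cong e eq) (e∘coverIndex j)))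

module _ {n d : ℕ} (p : Subset n) {e : Fin d → Fin n} (cover : Covers e (_∈ p)) where
  private
    E = enumerate p

    index : Fin ∣ p ∣ → Fin d
    index = coverIndex cover (elem E) (elem∈ E)

    index-injective : ∀ {i j} → index i ≡ index j → i ≡ j
    index-injective = coverIndex-injective cover (elem E) (elem∈ E) (elem-injective E)

  ∣p∣≤-covered : ∣ p ∣ ≤ d
  ∣p∣≤-covered = injective⇒≤ index-injective

  ∣p∣<-covered : ∀ a → e a ∉ p → ∣ p ∣ < d
  ∣p∣<-covered a ea∉p = injective-missing⇒< index index-injective a a≢index
    where
    a≢index : ∀ i → a ≢ index i
    a≢index i refl = ea∉p (subst (_∈ p) (sym (e∘coverIndex cover (elem E) (elem∈ E) i)) (elem∈ E i))

≤∣p∣-injection : ∀ {c n} (p : Subset n) (g : Fin c → Fin n) → (∀ i → g i ∈ p) →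
                 (∀ {i j} → g i ≡ g j → i ≡ j) → c ≤ ∣ p ∣
≤∣p∣-injection p g g∈p g-injective =
  injective⇒≤ (coverIndex-injective (elem-onto (enumerate p)) g g∈p g-injective)

unblocked : ∀ {M N} → M < N → (B : Fin M → Fin N → Set) → (∀ j a → Dec (B j a)) →
            (∀ j {a b} → B j a → B j b → a ≡ b) → ∃ λ a → ∀ j → ¬ B j a
unblocked {N = N} M<N B B? blocks-once with any? (λ a → all? (λ j → ¬? (B? j a)))
... | yes free = free
... | no none = contradiction (injective⇒≤ blocker-injective) (<⇒≱ M<N)
  where
  blocked : ∀ a → ∃ λ j → B j a
  blocked a with any? (λ j → B? j a)
  ... | yes b = b
  ... | no ¬b = contradiction (a , λ j b → ¬b (j , b)) none
  blocker : Fin N → Fin _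
  blocker a = proj₁ (blocked a)
  blocker-injective : ∀ {a b} → blocker a ≡ blocker b → a ≡ b
  blocker-injective {a} {b} eq =
    blocks-once (blocker b) (subst (λ j → B j a) eq (proj₂ (blocked a))) (proj₂ (blocked b))

-- Functionality of graphs

module _ {N : ℕ} (A : Fin N → Fin N → Bool) where

  neighbours : Fin N → Subset N
  neighbours v = tabulate (A v)

  ∈-neighbours⁻ : ∀ {v w} → w ∈ neighbours v → A v w ≡ true
  ∈-neighbours⁻ {v} {w} w∈ = trans (sym (lookup∘tabulate (A v) w)) ([]=⇒lookup w∈)

  ∈-neighbours⁺ : ∀ {v w} → A v w ≡ true → w ∈ neighbours v
  ∈-neighbours⁺ {v} {w} vw = lookup⇒[]= w (neighbours v) (trans (lookup∘tabulate (A v) w) vw)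

  functionOf-neighbours : ∀ {S v} → A v v ≡ false → FunctionOf A S v ∣ S ∩ neighbours v ∣
  functionOf-neighbours {S} {v} loopless =
    us , (λ p → proj₁ (us∈ p)) , us≢v , us-distinct , (λ _ → false) , nonadjacent
    where
    E = enumerate (S ∩ neighbours v)
    us = tabulate (elem E)
    lookup-us : ∀ p → lookup us p ≡ elem E p
    lookup-us = lookup∘tabulate (elem E)
    us∈ : ∀ p → lookup us p ∈ S × A v (lookup us p) ≡ true
    us∈ p rewrite lookup-us p = map₂ ∈-neighbours⁻ (x∈p∩q⁻ S _ (elem∈ E p))
    us≢v : ∀ p → lookup us p ≢ v
    us≢v p eq with () ← trans (sym (subst (λ u → A v u ≡ true) eq (proj₂ (us∈ p)))) loopless
    us-distinct : ∀ p q → lookup us p ≡ lookup us q → p ≡ q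
    us-distinct p q eq = elem-injective E (trans (sym (lookup-us p)) (trans eq (lookup-us q)))
    nonadjacent : ∀ w → w ∈ S → w ≢ v → (∀ p → w ≢ lookup us p) → A v w ≡ false
    nonadjacent w w∈S _ w∉us = ¬-not λ vw →
      let (a , ea≡w) = elem-onto E w (x∈p∩q⁺ (w∈S , ∈-neighbours⁺ vw))
      in w∉us a (sym (trans (lookup-us a) ea≡w))

  private
    cover-∩ : ∀ {S v d} {e : Fin d → Fin N} → Covers e (λ w → A v w ≡ true) → Covers e (_∈ S ∩ neighbours v)
    cover-∩ {S} cover w w∈ = cover w (∈-neighbours⁻ (proj₂ (x∈p∩q⁻ S _ w∈)))

  funVertex≤-covered : ∀ {S v d} {e : Fin d → Fin N} → A v v ≡ false →
                       Covers e (λ w → A v w ≡ true) → FunVertexLe A S v d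
  funVertex≤-covered {S} loopless cover = _ , ∣p∣≤-covered _ (cover-∩ {S} cover) , functionOf-neighbours {S} loopless

  funVertex<-covered : ∀ {S v d} {e : Fin (suc d) → Fin N} → A v v ≡ false →
                       Covers e (λ w → A v w ≡ true) → ∀ {w} → A v w ≡ true → w ∉ S → FunVertexLe A S v d
  funVertex<-covered {S} {e = e} loopless cover vw w∉S with cover _ vw
  ... | a , ea≡w = _ , ≤-pred (∣p∣<-covered _ (cover-∩ {S} cover) a ea∉) , functionOf-neighbours {S} loopless
    where
    ea∉ : e a ∉ S ∩ _
    ea∉ ea∈ = w∉S (subst (_∈ S) ea≡w (proj₁ (x∈p∩q⁻ S _ ea∈)))

  Closed : Subset N → Set
  Closed S = ∀ {u w} → u ∈ S → A u w ≡ true → w ∈ S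

  leaving-edge : ∀ S → ¬ Closed S → ∃ λ u → u ∈ S × ∃ λ w → A u w ≡ true × w ∉ S
  leaving-edge S ¬closed with any? (λ u → any? (λ w → u ∈? S ×-dec (A u w ≟ᵇ true) ×-dec ¬? (w ∈? S)))
  ... | yes (u , w , u∈S , uw , w∉S) = u , u∈S , w , uw , w∉S
  ... | no none = ⊥-elim (¬closed closed)
    where
    closed : Closed S
    closed {u} {w} u∈S uw = decidable-stable (w ∈? S) (λ w∉S → none (u , w , u∈S , uw , w∉S))

record Separation {V : Set} (adj : V → V → Bool) (v : V) {i : ℕ} (U : Fin i → V) : Set where
  field
    w₁ w₂ : V
    w₁≢v : w₁ ≢ v
    w₂≢v : w₂ ≢ v
    w₁∉U : ∀ j → w₁ ≢ U j
    w₂∉U : ∀ j → w₂ ≢ U j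
    agree : ∀ j → adj w₁ (U j) ≡ adj w₂ (U j)
    differ : adj v w₁ ≢ adj v w₂

Isolated : ∀ {V : Set} → (V → V → Bool) → V → ∀ {i} → (Fin i → V) → Set
Isolated adj w U = ∀ j → w ≢ U j × adj w (U j) ≡ false

isolated⇒Separation : ∀ {V : Set} {adj : V → V → Bool} {v w₁ w₂ : V} {i} {U : Fin i → V} →
                      Isolated adj w₁ U → Isolated adj w₂ U → w₁ ≢ v → w₂ ≢ v →
                      adj v w₁ ≢ adj v w₂ → Separation adj v U
isolated⇒Separation {w₁ = w₁} {w₂} w₁-isolated w₂-isolated w₁≢v w₂≢v differ = record
  { w₁ = w₁
  ; w₂ = w₂
  ; w₁≢v = w₁≢v
  ; w₂≢v = w₂≢v
  ; w₁∉U = λ j → proj₁ (w₁-isolated j)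
  ; w₂∉U = λ j → proj₁ (w₂-isolated j)
  ; agree = λ j → trans (proj₂ (w₁-isolated j)) (sym (proj₂ (w₂-isolated j)))
  ; differ = differ
  }

Separation-map : ∀ {V W : Set} {adjV : V → V → Bool} {adjW : W → W → Bool} (φ : V → W) →
                 (∀ {a b} → φ a ≡ φ b → a ≡ b) → (∀ a b → adjW (φ a) (φ b) ≡ adjV a b) →
                 ∀ {v v′ i} {U : Fin i → V} {U′ : Fin i → W} → φ v ≡ v′ → (∀ j → φ (U j) ≡ U′ j) →
                 Separation adjV v U → Separation adjW v′ U′
Separation-map {adjV = adjV} {adjW} φ φ-injective φ-adj {v} {U = U} {U′} refl φU≡U′ sep = record
  { w₁ = φ w₁
  ; w₂ = φ w₂
  ; w₁≢v = λ eq → w₁≢v (φ-injective eq)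
  ; w₂≢v = λ eq → w₂≢v (φ-injective eq)
  ; w₁∉U = λ j eq → w₁∉U j (φ-injective (trans eq (sym (φU≡U′ j))))
  ; w₂∉U = λ j eq → w₂∉U j (φ-injective (trans eq (sym (φU≡U′ j))))
  ; agree = agree′
  ; differ = λ eq → differ (trans (sym (φ-adj v w₁)) (trans eq (φ-adj v w₂)))
  }
  where
  open Separation sep
  open ≡-Reasoning
  agree′ : ∀ j → adjW (φ w₁) (U′ j) ≡ adjW (φ w₂) (U′ j)
  agree′ j = begin
    adjW (φ w₁) (U′ j)    ≡⟨ cong (adjW (φ w₁)) (sym (φU≡U′ j)) ⟩
    adjW (φ w₁) (φ (U j)) ≡⟨ φ-adj w₁ (U j) ⟩
    adjV w₁ (U j)         ≡⟨ agree j ⟩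
    adjV w₂ (U j)         ≡⟨ sym (φ-adj w₂ (U j)) ⟩
    adjW (φ w₂) (φ (U j)) ≡⟨ cong (adjW (φ w₂)) (φU≡U′ j) ⟩
    adjW (φ w₂) (U′ j)    ∎

map-cong-lookup : ∀ {A B : Set} {f g : A → B} {i} (xs : Vec A i) →
                  (∀ p → f (lookup xs p) ≡ g (lookup xs p)) → map f xs ≡ map g xs
map-cong-lookup [] _ = refl
map-cong-lookup (x ∷ xs) f≗g = cong₂ _∷_ (f≗g zero) (map-cong-lookup xs (λ p → f≗g (suc p)))

module _ {N : ℕ} (A : Fin N → Fin N → Bool) where

  separation⇒¬functionOf : ∀ {v i} (fo : FunctionOf A ⊤ v i) → ¬ Separation A v (lookup (proj₁ fo))
  separation⇒¬functionOf {v} (us , _ , _ , _ , f , determined) sep = differ (begin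
    A v w₁              ≡⟨ determined w₁ ∈⊤ w₁≢v w₁∉U ⟩
    f (map (A w₁) us)   ≡⟨ cong f (map-cong-lookup us agree) ⟩
    f (map (A w₂) us)   ≡⟨ sym (determined w₂ ∈⊤ w₂≢v w₂∉U) ⟩
    A v w₂              ∎)
    where
    open Separation sep
    open ≡-Reasoning

  ¬FunLe-separable : Fin N → ∀ {t} →
    (∀ v {i} (us : Vec (Fin N) i) → i ≤ t → (∀ p → lookup us p ≢ v) → Separation A v (lookup us)) →
    ¬ FunLe A ⊤ t
  ¬FunLe-separable v₀ separable funLe with funLe ⊤ (λ v∈ → v∈) (v₀ , ∈⊤)
  ... | v , _ , i , i≤t , fo@(us , _ , us≢v , _) = separation⇒¬functionOf fo (separable v us i≤t us≢v)

-- Projective planes as self-dual incidence structures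

record Plane (k : ℕ) : Set where
  field
    np nl : ℕ
    I : Fin np → Fin nl → Bool
    connect : ∀ x y → x ≢ y → ∃ λ l → I x l ≡ true × I y l ≡ true
    connect-unique : ∀ {x y l l′} → x ≢ y → I x l ≡ true → I y l ≡ true →
                     I x l′ ≡ true → I y l′ ≡ true → l ≡ l′
    intersect : ∀ l l′ → l ≢ l′ → ∃ λ x → I x l ≡ true × I x l′ ≡ true
    intersect-unique : ∀ {l l′ x y} → l ≢ l′ → I x l ≡ true → I x l′ ≡ true →
                       I y l ≡ true → I y l′ ≡ true → x ≡ y
    points : ∀ l → Enumeration (suc k) (λ x → I x l ≡ true)
    lines : ∀ x → Enumeration (suc k) (λ l → I x l ≡ true)

dual : ∀ {k} → Plane k → Plane k
dual P = record
  { np = nl ; nl = np ; I = λ l x → I x l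
  ; connect = intersect ; connect-unique = intersect-unique
  ; intersect = connect ; intersect-unique = connect-unique
  ; points = lines ; lines = points
  }
  where open Plane P

Vertex : ∀ {k} → Plane k → Set
Vertex P = Fin (Plane.np P) ⊎ Fin (Plane.nl P)

incidence : ∀ {k} (P : Plane k) → Vertex P → Vertex P → Bool
incidence P (inj₁ x) (inj₂ l) = Plane.I P x l
incidence P (inj₂ l) (inj₁ x) = Plane.I P x l
incidence P (inj₁ _) (inj₁ _) = false
incidence P (inj₂ _) (inj₂ _) = false

incidence-swap : ∀ {k} (P : Plane k) a b → incidence P (swap a) (swap b) ≡ incidence (dual P) a b
incidence-swap P (inj₁ _) (inj₁ _) = refl
incidence-swap P (inj₁ _) (inj₂ _) = refl
incidence-swap P (inj₂ _) (inj₁ _) = refl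
incidence-swap P (inj₂ _) (inj₂ _) = refl

module PlaneProperties {k : ℕ} (P : Plane k) where
  open Plane P

  incidence-irreflexive : ∀ a → incidence P a a ≡ false
  incidence-irreflexive (inj₁ _) = refl
  incidence-irreflexive (inj₂ _) = refl

  neighbour : Vertex P → Fin (suc k) → Vertex P
  neighbour (inj₁ x) a = inj₂ (elem (lines x) a)
  neighbour (inj₂ l) a = inj₁ (elem (points l) a)

  neighbour-covers : ∀ a → Covers (neighbour a) (λ b → incidence P a b ≡ true)
  neighbour-covers (inj₁ x) (inj₂ l) xl = map₂ (cong inj₂) (elem-onto (lines x) l xl)
  neighbour-covers (inj₂ l) (inj₁ x) xl = map₂ (cong inj₁) (elem-onto (points l) x xl)

  connected : (S : Vertex P → Set) → (∀ {a b} → S a → incidence P a b ≡ true → S b) →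
              ∀ {a₀} → S a₀ → ∀ a → S a
  connected S closed {a₀} a₀∈S = every
    where
    somePoint : ∀ {a} → S a → ∃ λ x → S (inj₁ x)
    somePoint {inj₁ x} x∈S = x , x∈S
    somePoint {inj₂ l} l∈S = elem (points l) zero , closed l∈S (elem∈ (points l) zero)
    p = proj₁ (somePoint a₀∈S)
    p∈S = proj₂ (somePoint a₀∈S)
    everyPoint : ∀ y → S (inj₁ y)
    everyPoint y with p ≟ y
    ... | yes refl = p∈S
    ... | no p≢y = let (r , pr , yr) = connect p y p≢y in closed (closed {b = inj₂ r} p∈S pr) yr
    every : ∀ a → S a
    every (inj₁ y) = everyPoint y
    every (inj₂ r) = closed (everyPoint (elem (points r) zero)) (elem∈ (points r) zero)

  lineThroughAvoiding : ∀ x {c} (ls : Vec (Fin nl) c) → c ≤ k →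
                        ∃ λ r → I x r ≡ true × ∀ j → r ≢ lookup ls j
  lineThroughAvoiding x ls c≤k =
    let (a , free) = unblocked (s≤s c≤k) (λ j a → elem (lines x) a ≡ lookup ls j)
                       (λ j a → elem (lines x) a ≟ lookup ls j)
                       (λ j ea eb → elem-injective (lines x) (trans ea (sym eb)))
    in elem (lines x) a , elem∈ (lines x) a , free

module LineSeparation {k : ℕ} (P : Plane k) (2≤k : 2 ≤ k) where
  open Plane P
  open PlaneProperties P

  private
    1≤k : 1 ≤ k
    1≤k = ≤-trans (s≤s z≤n) 2≤k

  PointBlocker : Vertex P → Fin np → Set
  PointBlocker (inj₁ q) x = x ≡ q
  PointBlocker (inj₂ u) x = I x u ≡ true

  pointBlocker? : ∀ w x → Dec (PointBlocker w x)
  pointBlocker? (inj₁ q) x = x ≟ q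
  pointBlocker? (inj₂ u) x = I x u ≟ᵇ true

  ¬PointBlocker⇒isolated : ∀ w {x} → ¬ PointBlocker w x →
                           inj₁ x ≢ w × incidence P (inj₁ x) w ≡ false
  ¬PointBlocker⇒isolated (inj₁ q) ¬b = (λ eq → ¬b (inj₁-injective eq)) , refl
  ¬PointBlocker⇒isolated (inj₂ u) ¬b = (λ ()) , ¬-not ¬b

  isolatedPointOn : ∀ l {i} (U : Fin i → Vertex P) → i ≤ k → (∀ j → U j ≢ inj₂ l) →
                    ∃ λ x → I x l ≡ true × Isolated (incidence P) (inj₁ x) U
  isolatedPointOn l U i≤k U≢l =
    let (a , free) = unblocked (s≤s i≤k) (λ j a → PointBlocker (U j) (pt a))
                       (λ j a → pointBlocker? (U j) (pt a)) (λ j → blocks-once (U j) (U≢l j))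
    in pt a , elem∈ (points l) a , λ j → ¬PointBlocker⇒isolated (U j) (free j)
    where
    pt = elem (points l)
    blocks-once : ∀ w → w ≢ inj₂ l → ∀ {a b} → PointBlocker w (pt a) → PointBlocker w (pt b) → a ≡ b
    blocks-once (inj₁ q) _ ea eb = elem-injective (points l) (trans ea (sym eb))
    blocks-once (inj₂ u) u≢l ea eb = elem-injective (points l)
      (intersect-unique (λ l≡u → u≢l (cong inj₂ (sym l≡u))) (elem∈ (points l) _) ea (elem∈ (points l) _) eb)

  -- No line through the isolated point x is a line of U; letting such a line block l instead
  -- keeps i blockers against the k + 1 lines through x.
  LineBlocker : Fin nl → Vertex P → Fin nl → Set
  LineBlocker l (inj₁ q) r = I q r ≡ true
  LineBlocker l (inj₂ _) r = r ≡ l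

  lineBlocker? : ∀ l w r → Dec (LineBlocker l w r)
  lineBlocker? l (inj₁ q) r = I q r ≟ᵇ true
  lineBlocker? l (inj₂ _) r = r ≟ l

  IsLine : Vertex P → Set
  IsLine w = ∃ λ u → w ≡ inj₂ u

  isLine? : ∀ w → Dec (IsLine w)
  isLine? (inj₁ _) = no λ ()
  isLine? (inj₂ u) = yes (u , refl)

  isolatedLineThrough : ∀ l {x i} (U : Fin i → Vertex P) → i ≤ k → Isolated (incidence P) (inj₁ x) U →
                        (∃ λ j → IsLine (U j)) → ∃ λ r → I x r ≡ true × r ≢ l × Isolated (incidence P) (inj₂ r) U
  isolatedLineThrough l {x} U i≤k x-isolated (j₀ , u₀ , Uj₀≡u₀) =
    let (a , free) = unblocked (s≤s i≤k) (λ j a → LineBlocker l (U j) (ln a))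
                       (λ j a → lineBlocker? l (U j) (ln a)) (λ j → blocks-once (U j) (proj₁ (x-isolated j)))
    in ln a , elem∈ (lines x) a , subst (λ w → ¬ LineBlocker l w (ln a)) Uj₀≡u₀ (free j₀)
            , λ j → ¬LineBlocker⇒isolated (U j) (elem∈ (lines x) a) (proj₂ (x-isolated j)) (free j)
    where
    ln = elem (lines x)
    blocks-once : ∀ w → inj₁ x ≢ w → ∀ {a b} → LineBlocker l w (ln a) → LineBlocker l w (ln b) → a ≡ b
    blocks-once (inj₁ q) x≢q ea eb = elem-injective (lines x)
      (connect-unique (λ x≡q → x≢q (cong inj₁ x≡q)) (elem∈ (lines x) _) ea (elem∈ (lines x) _) eb)
    blocks-once (inj₂ _) _ ea eb = elem-injective (lines x) (trans ea (sym eb))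
    ¬LineBlocker⇒isolated : ∀ w {r} → I x r ≡ true → incidence P (inj₁ x) w ≡ false → ¬ LineBlocker l w r →
                            inj₂ r ≢ w × incidence P (inj₂ r) w ≡ false
    ¬LineBlocker⇒isolated (inj₁ q) _ _ ¬b = (λ ()) , ¬-not ¬b
    ¬LineBlocker⇒isolated (inj₂ u) xr xu _ = (λ { refl → contradiction (trans (sym xr) xu) λ () }) , refl

  -- The points of a line m ≠ l through x ∈ l, together with a point y ≠ x on a third line through x.
  pointsMeetingLineOnce : ∀ l → Σ (Fin (2 + k) → Fin np) λ e → (∀ {a b} → e a ≡ e b → a ≡ b) ×
                            (∀ {a b} → I (e a) l ≡ true → I (e b) l ≡ true → a ≡ b)
  pointsMeetingLineOnce l
    with lineThroughAvoiding (elem (points l) zero) (l ∷ []) 1≤k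
  ... | m , xm , m≢
    with lineThroughAvoiding (elem (points l) zero) (l ∷ m ∷ []) 2≤k
  ... | m′ , xm′ , m′≢
    with PlaneProperties.lineThroughAvoiding (dual P) m′ (elem (points l) zero ∷ []) 1≤k
  ... | y , ym′ , y≢ = e , e-injective , meets-l-once
    where
    x = elem (points l) zero
    xl = elem∈ (points l) zero
    y-only-on-m′ : ∀ {r} → I x r ≡ true → I y r ≡ true → m′ ≡ r
    y-only-on-m′ xr yr = connect-unique (y≢ zero) ym′ xm′ yr xr
    e : Fin (2 + k) → Fin np
    e zero = y
    e (suc a) = elem (points m) a
    y∉m : ∀ a → y ≢ elem (points m) a
    y∉m a eq = m′≢ (suc zero) (y-only-on-m′ xm (subst (λ z → I z m ≡ true) (sym eq) (elem∈ (points m) a)))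
    e-injective : ∀ {a b} → e a ≡ e b → a ≡ b
    e-injective {zero} {zero} _ = refl
    e-injective {zero} {suc b} eq = ⊥-elim (y∉m b eq)
    e-injective {suc a} {zero} eq = ⊥-elim (y∉m a (sym eq))
    e-injective {suc a} {suc b} eq = cong suc (elem-injective (points m) eq)
    meets-l-once : ∀ {a b} → I (e a) l ≡ true → I (e b) l ≡ true → a ≡ b
    meets-l-once {zero} {zero} _ _ = refl
    meets-l-once {zero} {suc _} yl _ = ⊥-elim (m′≢ zero (y-only-on-m′ xl yl))
    meets-l-once {suc _} {zero} _ yl = ⊥-elim (m′≢ zero (y-only-on-m′ xl yl))
    meets-l-once {suc a} {suc b} al bl = cong suc (elem-injective (points m)
      (intersect-unique (m≢ zero) (elem∈ (points m) a) al (elem∈ (points m) b) bl))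

  pointOffAvoiding : ∀ l {i} (U : Fin i → Vertex P) → i ≤ k →
                     ∃ λ y → I y l ≡ false × ∀ j → inj₁ y ≢ U j
  pointOffAvoiding l {i} U i≤k =
    let (a , free) = unblocked (s≤s (s≤s i≤k)) Blocker blocker? blocks-once
    in e a , ¬-not (free zero) , λ j eq → free (suc j) (sym eq)
    where
    e = proj₁ (pointsMeetingLineOnce l)
    Blocker : Fin (suc i) → Fin (2 + k) → Set
    Blocker zero a = I (e a) l ≡ true
    Blocker (suc j) a = U j ≡ inj₁ (e a)
    blocker? : ∀ j a → Dec (Blocker j a)
    blocker? zero a = I (e a) l ≟ᵇ true
    blocker? (suc j) a = ≡-dec _≟_ _≟_ (U j) (inj₁ (e a))
    blocks-once : ∀ j {a b} → Blocker j a → Blocker j b → a ≡ b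
    blocks-once zero = proj₂ (proj₂ (pointsMeetingLineOnce l))
    blocks-once (suc j) ea eb = proj₁ (proj₂ (pointsMeetingLineOnce l)) (inj₁-injective (trans (sym ea) eb))

  lineSeparation : ∀ l {i} (U : Fin i → Vertex P) → i ≤ k → (∀ j → U j ≢ inj₂ l) →
                   Separation (incidence P) (inj₂ l) U
  lineSeparation l U i≤k U≢l with isolatedPointOn l U i≤k U≢l | any? (λ j → isLine? (U j))
  ... | x , xl , x-isolated | yes line∈U =
    let (r , _ , r≢l , r-isolated) = isolatedLineThrough l U i≤k x-isolated line∈U
    in isolated⇒Separation x-isolated r-isolated (λ ()) (λ eq → r≢l (inj₂-injective eq))
         (λ xl≡false → contradiction (trans (sym xl) xl≡false) λ ())
  ... | x , xl , x-isolated | no ¬line∈U =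
    let (y , yl , y∉U) = pointOffAvoiding l U i≤k
    in isolated⇒Separation x-isolated (λ j → y∉U j , point-nonadjacent (U j) (λ line → ¬line∈U (j , line)))
         (λ ()) (λ ()) (λ xl≡yl → contradiction (trans (sym xl) (trans xl≡yl yl)) λ ())
    where
    point-nonadjacent : ∀ w {y} → ¬ IsLine w → incidence P (inj₁ y) w ≡ false
    point-nonadjacent (inj₁ _) _ = refl
    point-nonadjacent (inj₂ u) ¬line = ⊥-elim (¬line (u , refl))

separation : ∀ {k} (P : Plane k) → 2 ≤ k → ∀ v {i} (U : Fin i → Vertex P) → i ≤ k → (∀ j → U j ≢ v) →
             Separation (incidence P) v U
separation P 2≤k (inj₂ l) U i≤k U≢v = LineSeparation.lineSeparation P 2≤k l U i≤k U≢v
separation P 2≤k (inj₁ x) U i≤k U≢v =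
  Separation-map swap swap-injective (incidence-swap P) refl (λ j → swap-involutive (U j))
    (LineSeparation.lineSeparation (dual P) 2≤k x (λ j → swap (U j)) i≤k
      (λ j eq → U≢v j (trans (sym (swap-involutive (U j))) (cong swap eq))))
  where
  swap-injective : ∀ {a b : Vertex (dual P)} → swap a ≡ swap b → a ≡ b
  swap-injective {a} {b} eq = trans (sym (swap-involutive a)) (trans (cong swap eq) (swap-involutive b))

-- Projective planes given by a family of lines

module FromLineFamily {n m k : ℕ} (line : Fin m → Subset n) (isPlane : IsProjectivePlane line)
                      (order : HasOrder k line) where
  open IsProjectivePlane isPlane

  I : Fin n → Fin m → Bool
  I x l = lookup (line l) x

  I⇒∈ : ∀ {x l} → I x l ≡ true → x ∈ line l
  I⇒∈ {x} {l} = lookup⇒[]= x (line l)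

  connect : ∀ x y → x ≢ y → ∃ λ l → I x l ≡ true × I y l ≡ true
  connect x y x≢y = let (l , x∈l , y∈l , _) = pointsJoin x y x≢y in l , []=⇒lookup x∈l , []=⇒lookup y∈l

  connect-unique : ∀ {x y l l′} → x ≢ y → I x l ≡ true → I y l ≡ true →
                   I x l′ ≡ true → I y l′ ≡ true → l ≡ l′
  connect-unique {x} {y} {l} {l′} x≢y xl yl xl′ yl′ =
    let (_ , _ , _ , unique) = pointsJoin x y x≢y
    in trans (unique l (I⇒∈ xl) (I⇒∈ yl)) (sym (unique l′ (I⇒∈ xl′) (I⇒∈ yl′)))

  intersect : ∀ l l′ → l ≢ l′ → ∃ λ x → I x l ≡ true × I x l′ ≡ true
  intersect l l′ l≢l′ = let (x , x∈l , x∈l′ , _) = linesMeet l l′ l≢l′ in x , []=⇒lookup x∈l , []=⇒lookup x∈l′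

  intersect-unique : ∀ {l l′ x y} → l ≢ l′ → I x l ≡ true → I x l′ ≡ true →
                     I y l ≡ true → I y l′ ≡ true → x ≡ y
  intersect-unique {l} {l′} {x} {y} l≢l′ xl xl′ yl yl′ =
    let (_ , _ , _ , unique) = linesMeet l l′ l≢l′
    in trans (unique x (I⇒∈ xl) (I⇒∈ xl′)) (sym (unique y (I⇒∈ yl) (I⇒∈ yl′)))

  pointsOn : ∀ l → Enumeration (suc k) (λ x → I x l ≡ true)
  pointsOn l = Enumeration-⇔ []=⇒lookup I⇒∈ (enumerateOfSize (line l) (order l))

  private
    Y = proj₁ fourPoints
    Yenum = enumerateOfSize Y (proj₁ (proj₂ fourPoints))
    y = elem Yenum

  aPoint : Fin n
  aPoint = y zero

  -- punchIn i : Fin 3 → Fin 4 lists the indices other than i.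
  noThreeCollinear : ∀ l i → ¬ (∀ j → I (y (punchIn i j)) l ≡ true)
  noThreeCollinear l i collinear =
    contradiction (≤-trans three≤ (proj₂ (proj₂ fourPoints) l)) λ { (s≤s (s≤s ())) }
    where
    three≤ : 3 ≤ ∣ line l ∩ Y ∣
    three≤ = ≤∣p∣-injection (line l ∩ Y) (λ j → y (punchIn i j))
               (λ j → x∈p∩q⁺ (I⇒∈ (collinear j) , elem∈ Yenum (punchIn i j)))
               (λ eq → punchIn-injective i _ _ (elem-injective Yenum eq))

  private
    joining : ∀ a b → a ≢ b → ∃ λ l → I (y a) l ≡ true × I (y b) l ≡ true
    joining a b a≢b = connect (y a) (y b) (λ eq → a≢b (elem-injective Yenum eq))

    L₀₁ = joining zero (suc zero) λ ()
    L₂₃ = joining (suc (suc zero)) (suc (suc (suc zero))) λ ()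
    L₀₂ = joining zero (suc (suc zero)) λ ()

  -- If x = y₀ then L₂₃ holds y₀, y₂, y₃; otherwise L₀₁ = L₀₂ holds y₀, y₁, y₂.
  lineMissing : ∀ x → ∃ λ l → I x l ≡ false
  lineMissing x with I x (proj₁ L₀₁) in x₀₁ | I x (proj₁ L₂₃) in x₂₃ | I x (proj₁ L₀₂) in x₀₂
  ... | false | _ | _ = proj₁ L₀₁ , x₀₁
  ... | true | false | _ = proj₁ L₂₃ , x₂₃
  ... | true | true | false = proj₁ L₀₂ , x₀₂
  ... | true | true | true with x ≟ y zero
  ...   | yes refl = ⊥-elim (noThreeCollinear (proj₁ L₂₃) (suc zero)
            λ { zero → x₂₃ ; (suc zero) → proj₁ (proj₂ L₂₃) ; (suc (suc zero)) → proj₂ (proj₂ L₂₃) })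
  ...   | no x≢y₀ = ⊥-elim (noThreeCollinear (proj₁ L₀₁) (suc (suc (suc zero)))
            λ { zero → proj₁ (proj₂ L₀₁) ; (suc zero) → proj₂ (proj₂ L₀₁)
              ; (suc (suc zero)) → subst (λ l → I (y (suc (suc zero))) l ≡ true) L₀₂≡L₀₁ (proj₂ (proj₂ L₀₂)) })
    where
    L₀₂≡L₀₁ : proj₁ L₀₂ ≡ proj₁ L₀₁
    L₀₂≡L₀₁ = connect-unique x≢y₀ x₀₂ (proj₁ (proj₂ L₀₂)) x₀₁ (proj₁ (proj₂ L₀₁))

  -- Joining x to the points of a line l′ missing x enumerates the lines through x.
  pencil : ∀ x l′ → I x l′ ≡ false → Enumeration (suc k) (λ l → I x l ≡ true)
  pencil x l′ xl′ = record { elem = ln ; elem∈ = x∈ln ; elem-injective = ln-injective ; elem-onto = onto }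
    where
    pt = elem (pointsOn l′)
    pt∈l′ = elem∈ (pointsOn l′)
    x≢pt : ∀ a → x ≢ pt a
    x≢pt a refl = contradiction (trans (sym (pt∈l′ a)) xl′) λ ()
    ln : Fin (suc k) → Fin m
    ln a = proj₁ (connect x (pt a) (x≢pt a))
    x∈ln : ∀ a → I x (ln a) ≡ true
    x∈ln a = proj₁ (proj₂ (connect x (pt a) (x≢pt a)))
    pt∈ln : ∀ a → I (pt a) (ln a) ≡ true
    pt∈ln a = proj₂ (proj₂ (connect x (pt a) (x≢pt a)))
    ≢l′ : ∀ {r} → I x r ≡ true → r ≢ l′
    ≢l′ xr refl = contradiction (trans (sym xr) xl′) λ ()
    ln-injective : ∀ {a b} → ln a ≡ ln b → a ≡ b
    ln-injective {a} {b} eq = elem-injective (pointsOn l′) (intersect-unique (≢l′ (x∈ln a))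
      (pt∈ln a) (pt∈l′ a) (subst (λ r → I (pt b) r ≡ true) (sym eq) (pt∈ln b)) (pt∈l′ b))
    onto : Covers ln (λ l → I x l ≡ true)
    onto r xr =
      let (q , qr , ql′) = intersect r l′ (≢l′ xr)
          (a , pt≡q) = elem-onto (pointsOn l′) q ql′
      in a , connect-unique (x≢pt a) (x∈ln a) (pt∈ln a) xr (subst (λ z → I z r ≡ true) (sym pt≡q) qr)

  plane : Plane k
  plane = record
    { np = n ; nl = m ; I = I
    ; connect = connect ; connect-unique = connect-unique
    ; intersect = intersect ; intersect-unique = intersect-unique
    ; points = pointsOn
    ; lines = λ x → pencil x (proj₁ (lineMissing x)) (proj₂ (lineMissing x))
    }

-- The incidence graph

module IncidenceGraph {n m k : ℕ} (line : Fin m → Subset n) (isPlane : IsProjectivePlane line)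
                      (order : HasOrder k line) where
  open FromLineFamily line isPlane order using (plane; aPoint)
  open PlaneProperties plane

  incAdj-splitAt : ∀ u w → incAdj line u w ≡ incidence plane (splitAt n u) (splitAt n w)
  incAdj-splitAt u w with splitAt n u | splitAt n w
  ... | inj₁ _ | inj₁ _ = refl
  ... | inj₁ _ | inj₂ _ = refl
  ... | inj₂ _ | inj₁ _ = refl
  ... | inj₂ _ | inj₂ _ = refl

  incAdj-join : ∀ a b → incAdj line (join n m a) (join n m b) ≡ incidence plane a b
  incAdj-join a b = trans (incAdj-splitAt _ _) (cong₂ (incidence plane) (splitAt-join n m a) (splitAt-join n m b))

  incAdj-irreflexive : ∀ u → incAdj line u u ≡ false
  incAdj-irreflexive u = trans (incAdj-splitAt u u) (incidence-irreflexive (splitAt n u))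

  incAdj-covered : ∀ u → Covers (λ a → join n m (neighbour (splitAt n u) a)) (λ w → incAdj line u w ≡ true)
  incAdj-covered u w uw =
    let (a , eq) = neighbour-covers (splitAt n u) (splitAt n w) (trans (sym (incAdj-splitAt u w)) uw)
    in a , trans (cong (join n m) eq) (join-splitAt n m w)

  closed⇒all : ∀ S → Closed (incAdj line) S → Nonempty S → ∀ u → u ∈ S
  closed⇒all S closed (u₀ , u₀∈S) u = subst (_∈ S) (join-splitAt n m u)
    (connected (λ a → join n m a ∈ S) (λ {a} {b} a∈S ab → closed a∈S (trans (incAdj-join a b) ab))
      {splitAt n u₀} (subst (_∈ S) (sym (join-splitAt n m u₀)) u₀∈S) (splitAt n u))

  separable : 2 ≤ k → ∀ v {i} (us : Vec (Fin (n + m)) i) → i ≤ k → (∀ p → lookup us p ≢ v) →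
              Separation (incAdj line) v (lookup us)
  separable 2≤k v us i≤k us≢v =
    Separation-map (join n m) join-injective incAdj-join (join-splitAt n m v) (λ p → join-splitAt n m (lookup us p))
      (separation plane 2≤k (splitAt n v) (λ p → splitAt n (lookup us p)) i≤k
        (λ p eq → us≢v p (splitAt-injective eq)))
    where
    join-injective : ∀ {a b} → join n m a ≡ join n m b → a ≡ b
    join-injective {a} {b} eq = trans (sym (splitAt-join n m a)) (trans (cong (splitAt n) eq) (splitAt-join n m b))
    splitAt-injective : ∀ {u w} → splitAt n u ≡ splitAt n w → u ≡ w
    splitAt-injective {u} {w} eq = trans (sym (join-splitAt n m u)) (trans (cong (join n m) eq) (join-splitAt n m w))

  fun≤k+1 : FunLe (incAdj line) ⊤ (suc k)
  fun≤k+1 S _ (v , v∈S) = v , v∈S , funVertex≤-covered (incAdj line) (incAdj-irreflexive v) (incAdj-covered v)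

  k+1≤fun : 2 ≤ k → ∀ t → t < suc k → ¬ FunLe (incAdj line) ⊤ t
  k+1≤fun 2≤k t t<k+1 = ¬FunLe-separable (incAdj line) (join n m (inj₁ aPoint))
    (λ v us i≤t → separable 2≤k v us (≤-trans i≤t (≤-pred t<k+1)))

  proper⇒fun≤k : ∀ S → S ≢ ⊤ → FunLe (incAdj line) S k
  proper⇒fun≤k S S≢⊤ S′ S′⊆S S′-nonempty =
    let (u , u∈S′ , w , uw , w∉S′) = leaving-edge (incAdj line) S′ λ closed →
          S≢⊤ (⊆-antisym ⊆⊤ (λ {x} _ → S′⊆S (closed⇒all S′ closed S′-nonempty x)))
    in u , u∈S′ , funVertex<-covered (incAdj line) (incAdj-irreflexive u) (incAdj-covered u) uw w∉S′

theorem1 : ∀ (k n m : ℕ) (line : Fin m → Subset n) → 2 ≤ k →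
    IsProjectivePlane line → HasOrder k line →
    FunEq (incAdj line) ⊤ (suc k) ×
    (∀ (S : Subset (n + m)) → S ≢ ⊤ → FunLe (incAdj line) S k)
theorem1 k n m line 2≤k isPlane order = (fun≤k+1 , k+1≤fun 2≤k) , proper⇒fun≤k
  where open IncidenceGraph line isPlane order
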